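{- There exist infinitely many integers $n$ such that each of the five terms $n$, $n+4$, $n+8$, $n+12$, $n+16$ of the arithmetic progression with common difference $4$ can be written in the form $a^2+b^2$ with $a,b$ nonzero integers. -}

module Defs where

open import Data.Integer using (ℤ; _+_; _*_; 0ℤ)
open import Data.Product using (∃-syntax; _×_)
open import Relation.Binary.PropositionalEquality using (_≡_; _≢_)

IsSumOfTwoNonzeroSquares : ℤ → Set
IsSumOfTwoNonzeroSquares n =
  ∃[ a ] ∃[ b ] (a ≢ 0ℤ × b ≢ 0ℤ × n ≡ a * a + b * b)

-- Let s ≡ 1 (mod 5), X = s² − 1 (so 5 ∣ X) and suppose 2s² + 9 = x² is a square. Then
--   X²      = (3X/5)² + (4X/5)²,      X² + 4  = X² + 2²,
--   X² + 8  = (X − 2)² + (2s)²,       X² + 12 = (X − 1)² + x²,      X² + 16 = X² + 4²,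
-- where the middle two use X + 1 = s² and x² = 2s² + 9. The Pell equation x² − 2y² = 9 has the
-- solution (9, 6) with 6 ≡ 1 (mod 5), and multiplying x + y√2 by a unit of ℤ[√2] that is ≡ 1 (mod 5)
-- yields infinitely many solutions with y ≡ 1 (mod 5), so n = X² can be taken arbitrarily large.
module Submission where

open import Data.Product using (∃-syntax; _×_; _,_)
open import Relation.Binary.PropositionalEquality using (_≡_; refl; sym; cong; cong₂; subst; module ≡-Reasoning)
open import Defs

module PellEquation where

  open import Data.Nat using (ℕ; zero; suc; _+_; _*_; _≤_; _<_; z≤n)
  open import Data.Nat.Properties using (+-assoc; +-comm; +-cancelʳ-≡; ≤-<-trans; m≤m+n)
  open import Data.Nat.Tactic.RingSolver using (solve-∀)

  record Pell (N x y : ℕ) : Set where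
    constructor pell
    field
      norm : x * x ≡ N + 2 * (y * y)

  -- (ax + 2cy)² − 2(cx + ay)² = (a² − 2c²)(x² − 2y²), with both sides moved so that no subtraction occurs.
  brahmagupta : ∀ a c x y →
    (a * x + 2 * (c * y)) * (a * x + 2 * (c * y)) + 2 * ((a * a) * (y * y) + (c * c) * (x * x))
      ≡ 2 * ((c * x + a * y) * (c * x + a * y)) + ((a * a) * (x * x) + 4 * ((c * c) * (y * y)))
  brahmagupta = solve-∀

  norm-product : ∀ M N C Y →
    (M + 2 * C) * (N + 2 * Y) + 4 * (C * Y) ≡ M * N + 2 * ((M + 2 * C) * Y + C * (N + 2 * Y))
  norm-product = solve-∀

  Pell-* : ∀ {M N a c x y} → Pell M a c → Pell N x y →
           Pell (M * N) (a * x + 2 * (c * y)) (c * x + a * y)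
  Pell-* {M} {N} {a} {c} {x} {y} (pell a²≡) (pell x²≡) = pell (+-cancelʳ-≡ K _ _ (begin
      (a * x + 2 * (c * y)) * (a * x + 2 * (c * y)) + K
    ≡⟨ brahmagupta a c x y ⟩
      R + ((a * a) * (x * x) + 4 * ((c * c) * (y * y)))
    ≡⟨ cong₂ (λ A X → R + (A * X + 4 * ((c * c) * (y * y)))) a²≡ x²≡ ⟩
      R + ((M + 2 * (c * c)) * (N + 2 * (y * y)) + 4 * ((c * c) * (y * y)))
    ≡⟨ cong (R +_) (norm-product M N (c * c) (y * y)) ⟩
      R + (M * N + 2 * ((M + 2 * (c * c)) * (y * y) + (c * c) * (N + 2 * (y * y))))
    ≡⟨ cong₂ (λ A X → R + (M * N + 2 * (A * (y * y) + (c * c) * X))) (sym a²≡) (sym x²≡) ⟩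
      R + (M * N + K)
    ≡⟨ sym (+-assoc R (M * N) K) ⟩
      R + M * N + K
    ≡⟨ cong (_+ K) (+-comm R (M * N)) ⟩
      M * N + R + K
    ∎))
    where
    open ≡-Reasoning
    K R : ℕ
    K = 2 * ((a * a) * (y * y) + (c * c) * (x * x))
    R = 2 * ((c * x + a * y) * (c * x + a * y))

  -- (3 + 2√2)⁶ = 19601 + 13860√2; as 19601 ≡ 1 and 13860 ≡ 0 (mod 5), multiplying by it preserves y mod 5.
  unit⁶ : Pell 1 19601 13860
  unit⁶ = pell refl

  pell₉-step : ∀ {t x} → Pell 9 x (6 + 5 * t) → ∃[ t′ ] ∃[ x′ ] (t < t′ × Pell 9 x′ (6 + 5 * t′))
  pell₉-step {t} {x} sol =
    t′ , x′ , subst (t <_) (sym (t′-expanded x t)) (m≤m+n (suc t) _) ,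
    subst (Pell 9 x′) (y′≡1-mod-5 x t) (Pell-* unit⁶ sol)
    where
    t′ x′ : ℕ
    t′ = 2772 * x + 19601 * t + 23520
    x′ = 19601 * x + 2 * (13860 * (6 + 5 * t))
    y′≡1-mod-5 : ∀ x t → 13860 * x + 19601 * (6 + 5 * t) ≡ 6 + 5 * (2772 * x + 19601 * t + 23520)
    y′≡1-mod-5 = solve-∀
    t′-expanded : ∀ x t → 2772 * x + 19601 * t + 23520 ≡ suc t + (2772 * x + 19600 * t + 23519)
    t′-expanded = solve-∀

  pell₉-unbounded : ∀ k → ∃[ t ] ∃[ x ] (k ≤ t × Pell 9 x (6 + 5 * t))
  pell₉-unbounded zero = 0 , 9 , z≤n , pell refl
  pell₉-unbounded (suc k) =
    let t , _ , k≤t , sol = pell₉-unbounded k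
        t′ , x′ , t<t′ , sol′ = pell₉-step sol
    in t′ , x′ , ≤-<-trans k≤t t<t′ , sol′

module SquareSums where

  open import Data.Nat using (ℕ; zero; suc; _+_; _*_; _≤_; _<_; NonZero; ≢-nonZero⁻¹)
  open import Data.Nat.Properties using (*-suc; m≤m*n; m≤n*m; m≤n+m; m≤m+n; module ≤-Reasoning)
  open import Data.Nat.Tactic.RingSolver using (solve-∀)
  import Data.Integer as ℤ
  open ℤ using (+_)
  open import Data.Integer.Properties using (+-injective; pos-+; pos-*)
  open PellEquation

  sumOfNonzeroSquares : ∀ a b {n} .{{_ : NonZero a}} .{{_ : NonZero b}} →
                        n ≡ a * a + b * b → IsSumOfTwoNonzeroSquares (+ n)
  sumOfNonzeroSquares a b {n} n≡ =
    + a , + b , (λ a≡0 → ≢-nonZero⁻¹ a (+-injective a≡0)) , (λ b≡0 → ≢-nonZero⁻¹ b (+-injective b≡0)) ,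
    (begin
      + n                       ≡⟨ cong +_ n≡ ⟩
      + (a * a + b * b)         ≡⟨ pos-+ (a * a) (b * b) ⟩
      + (a * a) ℤ.+ + (b * b)   ≡⟨ cong₂ ℤ._+_ (pos-* a a) (pos-* b b) ⟩
      + a ℤ.* + a ℤ.+ + b ℤ.* + b ∎)
    where open ≡-Reasoning

  pythagorean : ∀ a → (5 * a) * (5 * a) ≡ (3 * a) * (3 * a) + (4 * a) * (4 * a)
  pythagorean = solve-∀

  square+8 : ∀ {X} Y s → X ≡ 2 + Y → 1 + X ≡ s * s → X * X + 8 ≡ Y * Y + (2 * s) * (2 * s)
  square+8 Y s refl s²≡ = begin
    (2 + Y) * (2 + Y) + 8       ≡⟨ expand Y ⟩
    Y * Y + 4 * (1 + (2 + Y))   ≡⟨ cong (λ S → Y * Y + 4 * S) s²≡ ⟩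
    Y * Y + 4 * (s * s)         ≡⟨ cong (λ S → Y * Y + S) (double-square s) ⟩
    Y * Y + (2 * s) * (2 * s)   ∎
    where
    open ≡-Reasoning
    expand : ∀ Y → (2 + Y) * (2 + Y) + 8 ≡ Y * Y + 4 * (1 + (2 + Y))
    expand = solve-∀
    double-square : ∀ s → 4 * (s * s) ≡ (2 * s) * (2 * s)
    double-square = solve-∀

  square+12 : ∀ {X} Y s {x} → X ≡ 1 + Y → 1 + X ≡ s * s → Pell 9 x s → X * X + 12 ≡ Y * Y + x * x
  square+12 Y s {x} refl s²≡ (pell x²≡) = begin
    (1 + Y) * (1 + Y) + 12          ≡⟨ expand Y ⟩
    Y * Y + (9 + 2 * (1 + (1 + Y))) ≡⟨ cong (λ S → Y * Y + (9 + 2 * S)) s²≡ ⟩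
    Y * Y + (9 + 2 * (s * s))       ≡⟨ cong (λ S → Y * Y + S) x²≡ ⟨
    Y * Y + x * x                   ∎
    where
    open ≡-Reasoning
    expand : ∀ Y → (1 + Y) * (1 + Y) + 12 ≡ Y * Y + (9 + 2 * (1 + (1 + Y)))
    expand = solve-∀

  SquareSumProgression : ℕ → Set
  SquareSumProgression n =
    IsSumOfTwoNonzeroSquares (+ n) × IsSumOfTwoNonzeroSquares (+ (n + 4)) ×
    IsSumOfTwoNonzeroSquares (+ (n + 8)) × IsSumOfTwoNonzeroSquares (+ (n + 12)) ×
    IsSumOfTwoNonzeroSquares (+ (n + 16))

  square-progression : ∀ w s x → 1 + 5 * suc w ≡ s * s → Pell 9 x s →
                       SquareSumProgression (5 * suc w * (5 * suc w))
  square-progression w zero x () _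
  square-progression w (suc _) zero _ (pell ())
  square-progression w s@(suc _) x@(suc _) s²≡ sol =
    sumOfNonzeroSquares (3 * suc w) (4 * suc w) (pythagorean (suc w)) ,
    sumOfNonzeroSquares X 2 refl ,
    sumOfNonzeroSquares (3 + 5 * w) (2 * s) (square+8 (3 + 5 * w) s (*-suc 5 w) s²≡) ,
    sumOfNonzeroSquares (4 + 5 * w) x (square+12 (4 + 5 * w) s (*-suc 5 w) s²≡ sol) ,
    sumOfNonzeroSquares X 4 refl
    where
    X : ℕ
    X = 5 * suc w

  square-progression-above : ∀ {k t x} → k ≤ t → Pell 9 x (6 + 5 * t) →
                             ∃[ n ] (k < n × SquareSumProgression n)
  square-progression-above {k} {t} {x} k≤t sol =
    X * X , k<X² , square-progression w (6 + 5 * t) x (s²≡ t) sol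
    where
    w X : ℕ
    w = 6 + 12 * t + 5 * (t * t)
    X = 5 * suc w
    s²≡ : ∀ t → 1 + 5 * (7 + 12 * t + 5 * (t * t)) ≡ (6 + 5 * t) * (6 + 5 * t)
    s²≡ = solve-∀
    open ≤-Reasoning
    k<X² : k < X * X
    k<X² = begin-strict
      k              ≤⟨ k≤t ⟩
      t              ≤⟨ m≤n*m t 12 ⟩
      12 * t         ≤⟨ m≤n+m (12 * t) 6 ⟩
      6 + 12 * t     ≤⟨ m≤m+n (6 + 12 * t) (5 * (t * t)) ⟩
      w              <⟨ m≤n*m (suc w) 5 ⟩
      X              ≤⟨ m≤m*n X X ⟩
      X * X          ∎

  square-progressions-unbounded : ∀ k → ∃[ n ] (k < n × SquareSumProgression n)
  square-progressions-unbounded k =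
    let _ , _ , k≤t , sol = pell₉-unbounded k in square-progression-above k≤t sol

open import Data.Integer using (ℤ; _+_; _>_; +_; _≤_; ∣_∣; -[1+_]; -≤+; +<+)
open import Data.Integer.Properties using (≤-refl; ≤-<-trans)
open SquareSums using (square-progressions-unbounded)

i≤+∣i∣ : ∀ i → i ≤ + ∣ i ∣
i≤+∣i∣ (+ n)      = ≤-refl
i≤+∣i∣ -[1+ n ]   = -≤+

theorem3p4 : (m : ℤ) → ∃[ n ] (n > m × IsSumOfTwoNonzeroSquares n × IsSumOfTwoNonzeroSquares (n + + 4) × IsSumOfTwoNonzeroSquares (n + + 8) × IsSumOfTwoNonzeroSquares (n + + 12) × IsSumOfTwoNonzeroSquares (n + + 16))
theorem3p4 m =
  let n , ∣m∣<n , progression = square-progressions-unbounded ∣ m ∣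
  in + n , ≤-<-trans (i≤+∣i∣ m) (+<+ ∣m∣<n) , progression
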